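{- There is a function $\varepsilon:\mathbb{N}\to\mathbb{R}$ with $\varepsilon(t)\to 0$ as $t\to\infty$ such that for every $t\in\mathbb{N}$ there exists a graph $G$ with average degree $\overline{\mathsf d}(G)\geq t$ such that $G$ does not contain a minor on $t$ vertices with more than $\left(\frac34+\varepsilon(t)\right)\binom{t}{2}$ edges.
   Context: All graphs are finite and simple. The average degree of a graph $G$ is $\overline{\mathsf d}(G)=\frac{\sum_{u\in V(G)}\deg_G(u)}{|V(G)|}$. A graph $H$ is a minor of $G$ if a graph isomorphic to $H$ can be obtained from a subgraph of $G$ by contracting edges (removing loops and parallel edges). -}

module Defs where

open import Data.Nat using (ℕ; _<ᵇ_)
open import Data.Bool using (Bool; true; false; _∧_)
open import Data.Fin using (Fin; toℕ)
open import Data.List using (List; length; filterᵇ; map; allFin)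
open import Data.Nat.ListAction using (sum)
open import Data.Maybe using (Maybe; just)
open import Data.Product using (Σ; ∃; ∃₂; _×_)
open import Relation.Binary.PropositionalEquality using (_≡_)

record Graph : Set where
  field
    n      : ℕ
    adj    : Fin n → Fin n → Bool
    sym    : ∀ i j → adj i j ≡ adj j i
    irrefl : ∀ i → adj i i ≡ false
open Graph public

Edge : (G : Graph) → Fin (n G) → Fin (n G) → Set
Edge G u v = adj G u v ≡ true

deg : (G : Graph) → Fin (n G) → ℕ
deg G u = length (filterᵇ (adj G u) (allFin (n G)))

degSum : Graph → ℕ
degSum G = sum (map (deg G) (allFin (n G)))

edgeCount : Graph → ℕ
edgeCount G = sum (map (λ i → length (filterᵇ (λ j → (toℕ i <ᵇ toℕ j) ∧ adj G i j)
                                                 (allFin (n G))))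
                       (allFin (n G)))

data Walk (G : Graph) (P : Fin (n G) → Set) : Fin (n G) → Fin (n G) → Set where
  here : ∀ {u} → P u → Walk G P u u
  step : ∀ {u w v} → P u → Edge G u w → Walk G P w v → Walk G P u v

-- H is a minor of G, via a minor model (branch sets): disjoint nonempty connected
-- vertex sets V_h ⊆ V(G) (h ∈ V(H)), with an edge of G between V_h and V_k
-- whenever hk ∈ E(H). (Standard equivalent of "obtained from a subgraph by contractions".)
record MinorModel (H G : Graph) : Set where
  field
    branch    : Fin (n G) → Maybe (Fin (n H))
    nonempty  : ∀ h → ∃ λ u → branch u ≡ just h
    connected : ∀ h u v → branch u ≡ just h → branch v ≡ just h →
                Walk G (λ w → branch w ≡ just h) u v
    edges     : ∀ h k → Edge H h k →
                ∃₂ λ u v → branch u ≡ just h × branch v ≡ just k × Edge G u v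

IsMinorOf : Graph → Graph → Set
IsMinorOf H G = MinorModel H G

{-# OPTIONS --safe #-}
module Submission where

-- Take G = K_{a,ta} with a = ⌈(t+1)/2⌉; its average degree 2a·ta/(a+ta) is at least t.
-- In a minor H of G on t vertices at most a branch sets meet the side of size a.
-- The others lie in the independent side, and every edge of G has an end in the
-- small side, so these s ≥ t - a ≥ (t-2)/2 vertices of H are pairwise nonadjacent.
-- Hence e(H) ≤ C(t,2) - C(s,2) ≤ (3/4 + 10/(t+1)) C(t,2), and ε(t) = 10/(t+1) works.

module Arithmetic where

  open import Data.Nat using (ℕ; zero; suc; _+_; _*_; _≤_; z≤n; s≤s; ⌊_/2⌋; ⌈_/2⌉)
  open import Data.Nat.Properties
  open import Data.Nat.Combinatorics using (_C_; nC1≡n; nCk+nC[k+1]≡[n+1]C[k+1])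
  open import Data.Nat.Tactic.RingSolver using (solve-∀)
  open import Relation.Binary.PropositionalEquality using (_≡_; refl; sym; trans; cong; module ≡-Reasoning)

  [1+n]C2≡n+nC2 : ∀ n → suc n C 2 ≡ n + n C 2
  [1+n]C2≡n+nC2 n = trans (sym (nCk+nC[k+1]≡[n+1]C[k+1] n 1)) (cong (_+ n C 2) (nC1≡n n))

  C2-mono : ∀ {m n} → m ≤ n → m C 2 ≤ n C 2
  C2-mono {zero}          _         = z≤n
  C2-mono {suc m} {suc n} (s≤s m≤n) = begin
    suc m C 2    ≡⟨ [1+n]C2≡n+nC2 m ⟩
    m + m C 2    ≤⟨ +-mono-≤ m≤n (C2-mono m≤n) ⟩
    n + n C 2    ≡⟨ [1+n]C2≡n+nC2 n ⟨
    suc n C 2    ∎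
    where open ≤-Reasoning

  2*nC2+n≡n*n : ∀ n → 2 * (n C 2) + n ≡ n * n
  2*nC2+n≡n*n zero    = refl
  2*nC2+n≡n*n (suc n) = begin
    2 * (suc n C 2) + suc n          ≡⟨ cong (λ c → 2 * c + suc n) ([1+n]C2≡n+nC2 n) ⟩
    2 * (n + n C 2) + suc n          ≡⟨ regroup n (n C 2) ⟩
    (2 * (n C 2) + n) + (suc n + n)  ≡⟨ cong (_+ (suc n + n)) (2*nC2+n≡n*n n) ⟩
    n * n + (suc n + n)              ≡⟨ square-suc n ⟩
    suc n * suc n                    ∎
    where
    open ≡-Reasoning
    regroup : ∀ n c → 2 * (n + c) + suc n ≡ (2 * c + n) + (suc n + n)
    regroup = solve-∀
    square-suc : ∀ n → n * n + (suc n + n) ≡ suc n * suc n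
    square-suc = solve-∀

  [2+2n]C2≡4*nC2+5n+1 : ∀ n → (2 + (n + n)) C 2 ≡ 4 * (n C 2) + 5 * n + 1
  [2+2n]C2≡4*nC2+5n+1 zero    = refl
  [2+2n]C2≡4*nC2+5n+1 (suc n) = begin
    (2 + (suc n + suc n)) C 2
      ≡⟨ cong (λ m → (3 + m) C 2) (+-suc n n) ⟩
    (4 + (n + n)) C 2
      ≡⟨ [1+n]C2≡n+nC2 (3 + (n + n)) ⟩
    (3 + (n + n)) + (3 + (n + n)) C 2
      ≡⟨ cong ((3 + (n + n)) +_) ([1+n]C2≡n+nC2 (2 + (n + n))) ⟩
    (3 + (n + n)) + ((2 + (n + n)) + (2 + (n + n)) C 2)
      ≡⟨ cong (λ c → (3 + (n + n)) + ((2 + (n + n)) + c)) ([2+2n]C2≡4*nC2+5n+1 n) ⟩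
    (3 + (n + n)) + ((2 + (n + n)) + (4 * (n C 2) + 5 * n + 1))
      ≡⟨ regroup n (n C 2) ⟩
    4 * (n + n C 2) + 5 * suc n + 1
      ≡⟨ cong (λ c → 4 * c + 5 * suc n + 1) ([1+n]C2≡n+nC2 n) ⟨
    4 * (suc n C 2) + 5 * suc n + 1
      ∎
    where
    open ≡-Reasoning
    regroup : ∀ n c → (3 + (n + n)) + ((2 + (n + n)) + (4 * c + 5 * n + 1)) ≡ 4 * (n + c) + 5 * suc n + 1
    regroup = solve-∀

  tC2≤4*sC2+5t+1 : ∀ {t s} → t ≤ 2 + (s + s) → s ≤ t → t C 2 ≤ 4 * (s C 2) + 5 * t + 1
  tC2≤4*sC2+5t+1 {t} {s} t≤2+2s s≤t = begin
    t C 2                      ≤⟨ C2-mono t≤2+2s ⟩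
    (2 + (s + s)) C 2          ≡⟨ [2+2n]C2≡4*nC2+5n+1 s ⟩
    4 * (s C 2) + 5 * s + 1    ≤⟨ +-monoˡ-≤ 1 (+-monoʳ-≤ (4 * (s C 2)) (*-monoʳ-≤ 5 s≤t)) ⟩
    4 * (s C 2) + 5 * t + 1    ∎
    where open ≤-Reasoning

  [1+t][5t+1]≤40*tC2 : ∀ {t} → 2 ≤ t → suc t * (5 * t + 1) ≤ 40 * (t C 2)
  [1+t][5t+1]≤40*tC2 {t@(suc (suc u))} (s≤s (s≤s z≤n)) = *-cancelˡ-≤ 2 (+-cancelʳ-≤ (40 * t) _ _ (begin
    2 * (suc t * (5 * t + 1)) + 40 * t           ≤⟨ m≤m+n _ slack ⟩
    2 * (suc t * (5 * t + 1)) + 40 * t + slack   ≡⟨ expand u ⟩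
    40 * (t * t)                                 ≡⟨ cong (40 *_) (2*nC2+n≡n*n t) ⟨
    40 * (2 * (t C 2) + t)                       ≡⟨ distribute (t C 2) t ⟩
    2 * (40 * (t C 2)) + 40 * t                  ∎))
    where
    open ≤-Reasoning
    -- right-hand side minus left-hand side, as a polynomial in u
    slack : ℕ
    slack = 14 + 68 * u + 30 * (u * u)
    expand : ∀ u → 2 * ((3 + u) * (5 * (2 + u) + 1)) + 40 * (2 + u) + (14 + 68 * u + 30 * (u * u))
                   ≡ 40 * ((2 + u) * (2 + u))
    expand = solve-∀
    distribute : ∀ c t → 40 * (2 * c + t) ≡ 2 * (40 * c) + 40 * t
    distribute = solve-∀

  [1+t]tC2≤4[1+t]sC2+40tC2 : ∀ {t s} → t ≤ 2 + (s + s) → s ≤ t →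
                             suc t * (t C 2) ≤ 4 * suc t * (s C 2) + 40 * (t C 2)
  [1+t]tC2≤4[1+t]sC2+40tC2 {zero}                  _      _   = z≤n
  [1+t]tC2≤4[1+t]sC2+40tC2 {suc zero}              _      _   = z≤n
  [1+t]tC2≤4[1+t]sC2+40tC2 {t@(suc (suc _))} {s} t≤2+2s s≤t = begin
    suc t * (t C 2)                            ≤⟨ *-monoʳ-≤ (suc t) (tC2≤4*sC2+5t+1 t≤2+2s s≤t) ⟩
    suc t * (4 * (s C 2) + 5 * t + 1)          ≡⟨ distribute t (s C 2) ⟩
    4 * suc t * (s C 2) + suc t * (5 * t + 1)  ≤⟨ +-monoʳ-≤ (4 * suc t * (s C 2)) ([1+t][5t+1]≤40*tC2 (s≤s (s≤s z≤n))) ⟩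
    4 * suc t * (s C 2) + 40 * (t C 2)         ∎
    where
    open ≤-Reasoning
    distribute : ∀ t c → suc t * (4 * c + 5 * t + 1) ≡ 4 * suc t * c + suc t * (5 * t + 1)
    distribute = solve-∀

  4[1+t]E≤[3[1+t]+40]tC2 : ∀ {t a s E} → a + a ≤ 2 + t → t ≤ a + s → s ≤ t → E + s C 2 ≤ t C 2 →
                           4 * suc t * E ≤ (3 * suc t + 40) * (t C 2)
  4[1+t]E≤[3[1+t]+40]tC2 {t} {a} {s} {E} a+a≤2+t t≤a+s s≤t E+sC2≤tC2 =
    +-cancelʳ-≤ (4 * suc t * (s C 2)) _ _ (begin
      4 * suc t * E + 4 * suc t * (s C 2)
        ≡⟨ *-distribˡ-+ (4 * suc t) E (s C 2) ⟨
      4 * suc t * (E + s C 2)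
        ≤⟨ *-monoʳ-≤ (4 * suc t) E+sC2≤tC2 ⟩
      4 * suc t * (t C 2)
        ≡⟨ split t (t C 2) ⟩
      3 * suc t * (t C 2) + suc t * (t C 2)
        ≤⟨ +-monoʳ-≤ (3 * suc t * (t C 2)) ([1+t]tC2≤4[1+t]sC2+40tC2 t≤2+2s s≤t) ⟩
      3 * suc t * (t C 2) + (4 * suc t * (s C 2) + 40 * (t C 2))
        ≡⟨ regroup t (t C 2) (s C 2) ⟩
      (3 * suc t + 40) * (t C 2) + 4 * suc t * (s C 2)
        ∎)
    where
    open ≤-Reasoning
    interchange : ∀ a s → (a + s) + (a + s) ≡ (a + a) + (s + s)
    interchange = solve-∀
    shift : ∀ t r → (2 + t) + r ≡ t + (2 + r)
    shift = solve-∀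
    t≤2+2s : t ≤ 2 + (s + s)
    t≤2+2s = +-cancelˡ-≤ t _ _ (begin
      t + t                  ≤⟨ +-mono-≤ t≤a+s t≤a+s ⟩
      (a + s) + (a + s)      ≡⟨ interchange a s ⟩
      (a + a) + (s + s)      ≤⟨ +-monoˡ-≤ (s + s) a+a≤2+t ⟩
      (2 + t) + (s + s)      ≡⟨ shift t (s + s) ⟩
      t + (2 + (s + s))      ∎)
    split : ∀ t c → 4 * suc t * c ≡ 3 * suc t * c + suc t * c
    split = solve-∀
    regroup : ∀ t c d → 3 * suc t * c + (4 * suc t * d + 40 * c) ≡ (3 * suc t + 40) * c + 4 * suc t * d
    regroup = solve-∀

  n≤⌈n/2⌉+⌈n/2⌉ : ∀ n → n ≤ ⌈ n /2⌉ + ⌈ n /2⌉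
  n≤⌈n/2⌉+⌈n/2⌉ n = begin
    n                  ≡⟨ ⌊n/2⌋+⌈n/2⌉≡n n ⟨
    ⌊ n /2⌋ + ⌈ n /2⌉  ≤⟨ +-monoˡ-≤ ⌈ n /2⌉ (⌊n/2⌋≤⌈n/2⌉ n) ⟩
    ⌈ n /2⌉ + ⌈ n /2⌉  ∎
    where open ≤-Reasoning

  ⌊n/2⌋+⌊n/2⌋≤n : ∀ n → ⌊ n /2⌋ + ⌊ n /2⌋ ≤ n
  ⌊n/2⌋+⌊n/2⌋≤n n = begin
    ⌊ n /2⌋ + ⌊ n /2⌋  ≤⟨ +-monoʳ-≤ ⌊ n /2⌋ (⌊n/2⌋≤⌈n/2⌉ n) ⟩
    ⌊ n /2⌋ + ⌈ n /2⌉  ≡⟨ ⌊n/2⌋+⌈n/2⌉≡n n ⟩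
    n                  ∎
    where open ≤-Reasoning

module Counting where

  open import Algebra.Properties.CommutativeSemigroup using (x∙yz≈y∙xz)
  open import Data.Bool using (Bool; true; false; not; _∧_; _∨_; if_then_else_)
  open import Data.Bool.Properties using (∨-zeroʳ; ∧-identityʳ)
  open import Data.Fin using (Fin; zero; suc; toℕ)
  open import Data.Fin.Properties using (_≟_)
  open import Data.Maybe using (Maybe; just; nothing)
  open import Data.Nat using (ℕ; zero; suc; _+_; _*_; _≤_; _<ᵇ_; z≤n; s≤s)
  open import Data.Nat.Properties
    using (+-0-commutativeMonoid; +-commutativeSemigroup; +-assoc; m≤m+n; +-mono-≤; +-monoʳ-≤;
           ≤-refl; ≤-trans; ≤-reflexive; module ≤-Reasoning)
  open import Algebra.Properties.CommutativeMonoid.Sum +-0-commutativeMonoid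
    using (sum; sum-cong-≗; ∑-distrib-+; sum-replicate-zero)
  open import Data.Nat.Combinatorics using (_C_)
  open import Function using (_∘_)
  open import Relation.Nullary using (does)
  open import Relation.Nullary.Decidable using (dec-true)
  open import Relation.Binary.PropositionalEquality using (_≡_; refl; sym; trans; cong; cong₂; module ≡-Reasoning)
  open Arithmetic using ([1+n]C2≡n+nC2)

  iverson : Bool → ℕ
  iverson true  = 1
  iverson false = 0

  count : ∀ {n} → (Fin n → Bool) → ℕ
  count p = sum (iverson ∘ p)

  sum-mono-≤ : ∀ {n} {f g : Fin n → ℕ} → (∀ i → f i ≤ g i) → sum f ≤ sum g
  sum-mono-≤ {zero}  f≤g = z≤n
  sum-mono-≤ {suc n} f≤g = +-mono-≤ (f≤g zero) (sum-mono-≤ (f≤g ∘ suc))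

  sum-if : ∀ {n} (p : Fin n → Bool) (x y : ℕ) →
           sum (λ i → if p i then x else y) ≡ count p * x + count (not ∘ p) * y
  sum-if {zero}  p x y = refl
  sum-if {suc n} p x y with p zero
  ... | true  = trans (cong (x +_) (sum-if (p ∘ suc) x y)) (sym (+-assoc x _ _))
  ... | false = trans (cong (y +_) (sum-if (p ∘ suc) x y))
                      (x∙yz≈y∙xz +-commutativeSemigroup y (count (p ∘ suc) * x) _)

  count-false : ∀ n → count {n} (λ _ → false) ≡ 0
  count-false n = sum-replicate-zero n

  count-true : ∀ n → count {n} (λ _ → true) ≡ n
  count-true zero    = refl
  count-true (suc n) = cong suc (count-true n)

  count-not : ∀ {n} (p : Fin n → Bool) → count p + count (not ∘ p) ≡ n
  count-not {n} p = begin
    count p + count (not ∘ p)                        ≡⟨ ∑-distrib-+ (iverson ∘ p) (iverson ∘ not ∘ p) ⟨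
    sum (λ i → iverson (p i) + iverson (not (p i)))  ≡⟨ sum-cong-≗ (iverson-not ∘ p) ⟩
    count {n} (λ _ → true)                           ≡⟨ count-true n ⟩
    n                                                ∎
    where
    open ≡-Reasoning
    iverson-not : ∀ b → iverson b + iverson (not b) ≡ 1
    iverson-not true  = refl
    iverson-not false = refl

  count≤n : ∀ {n} (p : Fin n → Bool) → count p ≤ n
  count≤n p = ≤-trans (m≤m+n (count p) _) (≤-reflexive (count-not p))

  count-∨ : ∀ {n} (p q : Fin n → Bool) → count (λ i → p i ∨ q i) ≤ count p + count q
  count-∨ p q = begin
    count (λ i → p i ∨ q i)                    ≤⟨ sum-mono-≤ (λ i → iverson-∨ (p i) (q i)) ⟩
    sum (λ i → iverson (p i) + iverson (q i))  ≡⟨ ∑-distrib-+ (iverson ∘ p) (iverson ∘ q) ⟩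
    count p + count q                          ∎
    where
    open ≤-Reasoning
    iverson-∨ : ∀ a b → iverson (a ∨ b) ≤ iverson a + iverson b
    iverson-∨ true  b = s≤s z≤n
    iverson-∨ false b = ≤-refl

  count-∧≤iverson : ∀ {n} x (p : Fin n → Bool) → count p ≤ 1 → count (λ i → x ∧ p i) ≤ iverson x
  count-∧≤iverson     true  p count-p≤1 = count-p≤1
  count-∧≤iverson {n} false p _         = ≤-reflexive (count-false n)

  iverson-∧-disjoint : ∀ x a b → (b ≡ true → a ≡ false) → iverson (x ∧ a) + iverson (x ∧ b) ≤ iverson x
  iverson-∧-disjoint false a     b     _    = z≤n
  iverson-∧-disjoint true  false true  _    = ≤-refl
  iverson-∧-disjoint true  false false _    = z≤n
  iverson-∧-disjoint true  true  false _    = ≤-refl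
  iverson-∧-disjoint true  true  true  b⇒¬a with () ← b⇒¬a refl

  any : ∀ {n} → (Fin n → Bool) → Bool
  any {zero}  p = false
  any {suc n} p = p zero ∨ any (p ∘ suc)

  any-intro : ∀ {n} (p : Fin n → Bool) i → p i ≡ true → any p ≡ true
  any-intro p zero    pi≡true = cong (_∨ any (p ∘ suc)) pi≡true
  any-intro p (suc i) pi≡true = trans (cong (p zero ∨_) (any-intro (p ∘ suc) i pi≡true)) (∨-zeroʳ (p zero))

  count-any≤sum-count : ∀ {m n} (q : Fin m → Fin n → Bool) →
                        count (λ j → any (λ i → q i j)) ≤ sum (λ i → count (q i))
  count-any≤sum-count {zero}  {n} q = ≤-reflexive (count-false n)
  count-any≤sum-count {suc m}     q =
    ≤-trans (count-∨ (q zero) _) (+-monoʳ-≤ (count (q zero)) (count-any≤sum-count (q ∘ suc)))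

  hits : ∀ {n} → Maybe (Fin n) → Fin n → Bool
  hits nothing  j = false
  hits (just i) j = does (i ≟ j)

  hits-refl : ∀ {n} (i : Fin n) → hits (just i) i ≡ true
  hits-refl i = dec-true (i ≟ i) refl

  count-hits≤1 : ∀ {n} (x : Maybe (Fin n)) → count (hits x) ≤ 1
  count-hits≤1 {n}     nothing        = ≤-trans (≤-reflexive (count-false n)) z≤n
  count-hits≤1 {suc n} (just zero)    = s≤s (≤-reflexive (count-false n))
  count-hits≤1 {suc n} (just (suc i)) = count-hits≤1 (just i)

  count-<ᵇ : ∀ a b → count {a + b} (λ u → toℕ u <ᵇ a) ≡ a
  count-<ᵇ zero    b = count-false b
  count-<ᵇ (suc a) b = cong suc (count-<ᵇ a b)

  _<ᶠ_ : ∀ {n} → Fin n → Fin n → Bool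
  i <ᶠ j = toℕ i <ᵇ toℕ j

  count-pairs : ∀ {n} (p : Fin n → Bool) →
                sum (λ i → count (λ j → (i <ᶠ j) ∧ (p i ∧ p j))) ≡ count p C 2
  count-pairs {zero}  p = refl
  count-pairs {suc n} p with p zero
  ... | true  = trans (cong (count (p ∘ suc) +_) (count-pairs (p ∘ suc)))
                      (sym ([1+n]C2≡n+nC2 (count (p ∘ suc))))
  ... | false = cong₂ _+_ (count-false n) (count-pairs (p ∘ suc))

  count-ordered-pairs : ∀ n → sum {n} (λ i → count (i <ᶠ_)) ≡ n C 2
  count-ordered-pairs n = begin
    sum {n} (λ i → count (i <ᶠ_))
      ≡⟨ sum-cong-≗ {n} (λ i → sum-cong-≗ (cong iverson ∘ ∧-identityʳ ∘ (i <ᶠ_))) ⟨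
    sum {n} (λ i → count (λ j → (i <ᶠ j) ∧ true))
      ≡⟨ count-pairs {n} (λ _ → true) ⟩
    count {n} (λ _ → true) C 2
      ≡⟨ cong (_C 2) (count-true n) ⟩
    n C 2
      ∎
    where open ≡-Reasoning

module Graphs where

  open import Data.Bool using (Bool; true; false; not; _∧_; _xor_; if_then_else_)
  open import Data.Bool.Properties using (xor-comm; xor-same)
  open import Data.Fin using (Fin; zero; suc; toℕ)
  open import Data.List using (length; filterᵇ; map; tabulate; allFin)
  open import Data.List.Properties using (map-tabulate)
  import Data.Nat.ListAction as List
  open import Data.Maybe using (just)
  open import Data.Nat using (ℕ; zero; suc; _+_; _*_; _≤_; _<ᵇ_)
  open import Data.Nat.Properties
    using (+-0-commutativeMonoid; +-cancelˡ-≡; +-monoˡ-≤; *-monoʳ-≤; module ≤-Reasoning)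
  open import Algebra.Properties.CommutativeMonoid.Sum +-0-commutativeMonoid
    using (sum; sum-cong-≗; ∑-distrib-+)
  open import Data.Nat.Combinatorics using (_C_)
  open import Data.Nat.Tactic.RingSolver using (solve-∀)
  open import Data.Product using (_,_)
  open import Function using (_∘_; id)
  open import Relation.Binary.PropositionalEquality using (_≡_; refl; sym; trans; cong; cong₂; module ≡-Reasoning)
  open import Defs using (Graph; n; adj; deg; degSum; edgeCount; MinorModel; IsMinorOf)
  open Counting
  open Arithmetic using (4[1+t]E≤[3[1+t]+40]tC2)

  length-filterᵇ-tabulate : ∀ {A : Set} {n} (p : A → Bool) (f : Fin n → A) →
                            length (filterᵇ p (tabulate f)) ≡ count (p ∘ f)
  length-filterᵇ-tabulate {n = zero}  p f = refl
  length-filterᵇ-tabulate {n = suc n} p f with p (f zero)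
  ... | true  = cong suc (length-filterᵇ-tabulate p (f ∘ suc))
  ... | false = length-filterᵇ-tabulate p (f ∘ suc)

  sum-tabulate : ∀ {n} (f : Fin n → ℕ) → List.sum (tabulate f) ≡ sum f
  sum-tabulate {zero}  f = refl
  sum-tabulate {suc n} f = cong (f zero +_) (sum-tabulate (f ∘ suc))

  sum-map-allFin : ∀ {n} (f : Fin n → ℕ) → List.sum (map f (allFin n)) ≡ sum f
  sum-map-allFin f = trans (cong List.sum (map-tabulate id f)) (sum-tabulate f)

  length-filterᵇ-allFin : ∀ {n} (p : Fin n → Bool) → length (filterᵇ p (allFin n)) ≡ count p
  length-filterᵇ-allFin p = length-filterᵇ-tabulate p id

  degSum≡sum-count-adj : (G : Graph) → degSum G ≡ sum (λ u → count (adj G u))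
  degSum≡sum-count-adj G =
    trans (sum-map-allFin (deg G)) (sum-cong-≗ (λ u → length-filterᵇ-allFin (adj G u)))

  edgeCount≡sum-count : (G : Graph) → edgeCount G ≡ sum (λ i → count (λ j → (i <ᶠ j) ∧ adj G i j))
  edgeCount≡sum-count G =
    trans (sum-map-allFin (λ i → length (filterᵇ (λ j → (i <ᶠ j) ∧ adj G i j) (allFin (n G)))))
          (sum-cong-≗ (λ i → length-filterᵇ-allFin (λ j → (i <ᶠ j) ∧ adj G i j)))

  IsIndependent : (G : Graph) → (Fin (n G) → Bool) → Set
  IsIndependent G I = ∀ i j → I i ≡ true → I j ≡ true → adj G i j ≡ false

  edgeCount+C2≤C2 : (G : Graph) (I : Fin (n G) → Bool) → IsIndependent G I →
                    edgeCount G + count I C 2 ≤ n G C 2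
  edgeCount+C2≤C2 G I independent = begin
    edgeCount G + count I C 2
      ≡⟨ cong₂ _+_ (edgeCount≡sum-count G) (sym (count-pairs I)) ⟩
    sum (λ i → count (adjacent i)) + sum (λ i → count (bothIn i))
      ≡⟨ ∑-distrib-+ (count ∘ adjacent) (count ∘ bothIn) ⟨
    sum (λ i → count (adjacent i) + count (bothIn i))
      ≤⟨ sum-mono-≤ pointwise ⟩
    sum {n G} (λ i → count (i <ᶠ_))
      ≡⟨ count-ordered-pairs (n G) ⟩
    n G C 2
      ∎
    where
    open ≤-Reasoning
    adjacent bothIn : Fin (n G) → Fin (n G) → Bool
    adjacent i j = (i <ᶠ j) ∧ adj G i j
    bothIn   i j = (i <ᶠ j) ∧ (I i ∧ I j)
    notBoth : ∀ i j → I i ∧ I j ≡ true → adj G i j ≡ false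
    notBoth i j _ with I i in Ii | I j in Ij
    ... | true | true = independent i j Ii Ij
    pointwise : ∀ i → count (adjacent i) + count (bothIn i) ≤ count (i <ᶠ_)
    pointwise i = begin
      count (adjacent i) + count (bothIn i)
        ≡⟨ ∑-distrib-+ (iverson ∘ adjacent i) (iverson ∘ bothIn i) ⟨
      sum (λ j → iverson (adjacent i j) + iverson (bothIn i j))
        ≤⟨ sum-mono-≤ (λ j → iverson-∧-disjoint (i <ᶠ j) _ _ (notBoth i j)) ⟩
      count (i <ᶠ_)
        ∎

  module CompleteBipartite (a b : ℕ) where

    isLeft : Fin (a + b) → Bool
    isLeft u = toℕ u <ᵇ a

    graph : Graph
    graph = record
      { n      = a + b
      ; adj    = λ u v → isLeft u xor isLeft v
      ; sym    = λ u v → xor-comm (isLeft u) (isLeft v)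
      ; irrefl = λ u → xor-same (isLeft u)
      }

    count-isLeft : count isLeft ≡ a
    count-isLeft = count-<ᵇ a b

    count-isRight : count (not ∘ isLeft) ≡ b
    count-isRight = +-cancelˡ-≡ a _ b (begin
      a + count (not ∘ isLeft)             ≡⟨ cong (_+ count (not ∘ isLeft)) count-isLeft ⟨
      count isLeft + count (not ∘ isLeft)  ≡⟨ count-not isLeft ⟩
      a + b                                ∎)
      where open ≡-Reasoning

    count-xor-isLeft : ∀ x → count (λ v → x xor isLeft v) ≡ (if x then b else a)
    count-xor-isLeft true  = count-isRight
    count-xor-isLeft false = count-isLeft

    degSum-graph : degSum graph ≡ a * b + b * a
    degSum-graph = begin
      degSum graph
        ≡⟨ degSum≡sum-count-adj graph ⟩
      sum (λ u → count (λ v → isLeft u xor isLeft v))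
        ≡⟨ sum-cong-≗ (count-xor-isLeft ∘ isLeft) ⟩
      sum (λ u → if isLeft u then b else a)
        ≡⟨ sum-if isLeft b a ⟩
      count isLeft * b + count (not ∘ isLeft) * a
        ≡⟨ cong₂ _+_ (cong (_* b) count-isLeft) (cong (_* a) count-isRight) ⟩
      a * b + b * a
        ∎
      where open ≡-Reasoning

    module _ {H : Graph} (M : MinorModel H graph) where
      open MinorModel M

      touchesLeft : Fin (n H) → Bool
      touchesLeft h = any (λ u → isLeft u ∧ hits (branch u) h)

      touchesLeft-intro : ∀ u h → isLeft u ≡ true → branch u ≡ just h → touchesLeft h ≡ true
      touchesLeft-intro u h u-left u∈h = any-intro (λ v → isLeft v ∧ hits (branch v) h) u (begin
        isLeft u ∧ hits (branch u) h  ≡⟨ cong₂ (λ x y → x ∧ hits y h) u-left u∈h ⟩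
        hits (just h) h               ≡⟨ hits-refl h ⟩
        true                          ∎)
        where open ≡-Reasoning

      count-touchesLeft≤ : count touchesLeft ≤ a
      count-touchesLeft≤ = begin
        count touchesLeft
          ≤⟨ count-any≤sum-count (λ u h → isLeft u ∧ hits (branch u) h) ⟩
        sum (λ u → count (λ h → isLeft u ∧ hits (branch u) h))
          ≤⟨ sum-mono-≤ (λ u → count-∧≤iverson (isLeft u) (hits (branch u)) (count-hits≤1 (branch u))) ⟩
        count isLeft
          ≡⟨ count-isLeft ⟩
        a
          ∎
        where open ≤-Reasoning

      untouched-independent : IsIndependent H (not ∘ touchesLeft)
      untouched-independent h k h-untouched k-untouched with adj H h k in hk
      ... | false = refl
      ... | true with edges h k hk
      ... | u , v , u∈h , v∈k , uv with isLeft u in u-left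
      -- in the second case uv : isLeft v ≡ true, since false xor x reduces to x
      ...   | true  with () ← trans (sym (cong not (touchesLeft-intro u h u-left u∈h))) h-untouched
      ...   | false with () ← trans (sym (cong not (touchesLeft-intro v k uv v∈k))) k-untouched

      n≤a+untouched : n H ≤ a + count (not ∘ touchesLeft)
      n≤a+untouched = begin
        n H                                            ≡⟨ count-not touchesLeft ⟨
        count touchesLeft + count (not ∘ touchesLeft)  ≤⟨ +-monoˡ-≤ _ count-touchesLeft≤ ⟩
        a + count (not ∘ touchesLeft)                  ∎
        where open ≤-Reasoning

  open CompleteBipartite public using () renaming (graph to completeBipartite)

  edgeCount-minor-of-completeBipartite :
    ∀ a b {t H} → a + a ≤ 2 + t → n H ≡ t → IsMinorOf H (completeBipartite a b) →
    4 * suc t * edgeCount H ≤ (3 * suc t + 40) * (t C 2)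
  edgeCount-minor-of-completeBipartite a b {H = H} a+a≤2+t refl M =
    4[1+t]E≤[3[1+t]+40]tC2 a+a≤2+t (n≤a+untouched M) (count≤n (not ∘ touchesLeft M))
      (edgeCount+C2≤C2 H (not ∘ touchesLeft M) (untouched-independent M))
    where open CompleteBipartite a b

  t*n≤degSum-completeBipartite : ∀ t a → suc t ≤ a + a →
    t * n (completeBipartite a (t * a)) ≤ degSum (completeBipartite a (t * a))
  t*n≤degSum-completeBipartite t a 1+t≤a+a = begin
    t * (a + t * a)          ≡⟨ factor t a ⟩
    t * a * suc t            ≤⟨ *-monoʳ-≤ (t * a) 1+t≤a+a ⟩
    t * a * (a + a)          ≡⟨ expand t a ⟩
    a * (t * a) + t * a * a  ≡⟨ CompleteBipartite.degSum-graph a (t * a) ⟨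
    degSum (completeBipartite a (t * a)) ∎
    where
    open ≤-Reasoning
    factor : ∀ t a → t * (a + t * a) ≡ t * a * suc t
    factor = solve-∀
    expand : ∀ t a → t * a * (a + a) ≡ a * (t * a) + t * a * a
    expand = solve-∀

module Density where

  open import Data.Nat using (ℕ; zero; suc; _+_; _*_; _≤_; s≤s)
  open import Data.Nat.Properties using (*-comm; *-identityʳ; ≤-trans; m≤n*m)
  open import Data.Integer as ℤ using (+_; -[1+_])
  open import Data.Integer.Properties using (pos-*)
  import Data.Rational as ℚ
  open ℚ using (ℚ; mkℚ; _/_; ∣_∣; 0ℚ; toℚᵘ)
  import Data.Rational.Properties as ℚₚ
  open ℚₚ using (toℚᵘ-fromℚᵘ; toℚᵘ-homo-+; toℚᵘ-homo-*; toℚᵘ-cancel-≤; toℚᵘ-cancel-<;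
                0≤p⇒∣p∣≡p; nonNegative⁻¹; normalize-nonNeg)
  open import Data.Rational.Unnormalised as ℚᵘ using (mkℚᵘ; *≤*; *<*; _≃_)
  import Data.Rational.Unnormalised.Properties as ℚᵘₚ
  open import Data.Product using (∃; _,_)
  open import Relation.Binary.PropositionalEquality using (_≡_; sym; trans; cong; subst₂)

  ε : ℕ → ℚ
  ε t = + 10 / suc t

  toℚᵘ-n/[1+d] : ∀ n d → toℚᵘ (+ n / suc d) ≃ mkℚᵘ (+ n) d
  toℚᵘ-n/[1+d] n d = toℚᵘ-fromℚᵘ (mkℚᵘ (+ n) d)

  ε-tendsto-0 : ∀ δ → 0ℚ ℚ.< δ → ∃ λ T → ∀ t → T ≤ t → ∣ ε t ∣ ℚ.< δ
  ε-tendsto-0 δ@(mkℚ (+ suc p) q _) _ = 10 * suc q , ε<δ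
    where
    ε<δ : ∀ t → 10 * suc q ≤ t → ∣ ε t ∣ ℚ.< δ
    ε<δ t T≤t = begin-strict
      ∣ ε t ∣  ≡⟨ 0≤p⇒∣p∣≡p (nonNegative⁻¹ (ε t) {{normalize-nonNeg 10 (suc t)}}) ⟩
      ε t      <⟨ toℚᵘ-cancel-< (ℚᵘₚ.<-respˡ-≃ (ℚᵘₚ.≃-sym (toℚᵘ-n/[1+d] 10 t)) (*<* cross-multiplied)) ⟩
      δ        ∎
      where
      open ℚₚ.≤-Reasoning
      cross-multiplied : + 10 ℤ.* + suc q ℤ.< + suc p ℤ.* + suc t
      cross-multiplied = subst₂ ℤ._<_ (pos-* 10 (suc q)) (pos-* (suc p) (suc t))
                                (ℤ.+<+ (≤-trans (s≤s T≤t) (m≤n*m (suc t) (suc p))))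
  ε-tendsto-0 (mkℚ (+ zero)   _ _) (ℚ.*<* (ℤ.+<+ ()))
  ε-tendsto-0 (mkℚ -[1+ _ ] _ _) (ℚ.*<* ())

  ≤-3/4+ε : ∀ t {E c} → 4 * suc t * E ≤ (3 * suc t + 40) * c →
            + E / 1 ℚ.≤ (+ 3 / 4 ℚ.+ ε t) ℚ.* (+ c / 1)
  ≤-3/4+ε t {E} {c} 4[1+t]E≤[3[1+t]+40]c = toℚᵘ-cancel-≤ (begin
    toℚᵘ (+ E / 1)
      ≃⟨ toℚᵘ-n/[1+d] E 0 ⟩
    mkℚᵘ (+ E) 0
      ≤⟨ *≤* (subst₂ ℤ._≤_ (pos-* E (4 * suc t * 1)) numerator (ℤ.+≤+ cleared)) ⟩
    (mkℚᵘ (+ 3) 3 ℚᵘ.+ mkℚᵘ (+ 10) t) ℚᵘ.* mkℚᵘ (+ c) 0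
      ≃⟨ rhs ⟨
    toℚᵘ ((+ 3 / 4 ℚ.+ ε t) ℚ.* (+ c / 1))
      ∎)
    where
    open ℚᵘₚ.≤-Reasoning
    rhs : toℚᵘ ((+ 3 / 4 ℚ.+ ε t) ℚ.* (+ c / 1)) ≃ (mkℚᵘ (+ 3) 3 ℚᵘ.+ mkℚᵘ (+ 10) t) ℚᵘ.* mkℚᵘ (+ c) 0
    rhs = ℚᵘₚ.≃-trans (toℚᵘ-homo-* (+ 3 / 4 ℚ.+ ε t) (+ c / 1))
            (ℚᵘₚ.*-cong (ℚᵘₚ.≃-trans (toℚᵘ-homo-+ (+ 3 / 4) (ε t))
                                     (ℚᵘₚ.+-cong (toℚᵘ-n/[1+d] 3 3) (toℚᵘ-n/[1+d] 10 t)))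
                        (toℚᵘ-n/[1+d] c 0))
    numerator : + ((3 * suc t + 40) * c * 1) ≡ (+ 3 ℤ.* + suc t ℤ.+ + 10 ℤ.* + 4) ℤ.* + c ℤ.* + 1
    numerator = trans (pos-* ((3 * suc t + 40) * c) 1) (cong (ℤ._* + 1) (pos-* (3 * suc t + 40) c))
    cleared : E * (4 * suc t * 1) ≤ (3 * suc t + 40) * c * 1
    cleared = subst₂ _≤_ (trans (*-comm (4 * suc t) E) (cong (E *_) (sym (*-identityʳ _))))
                         (sym (*-identityʳ _)) 4[1+t]E≤[3[1+t]+40]c

open import Defs
open import Data.Nat using (ℕ; _≤_; _*_; suc; z≤n; s≤s; ⌈_/2⌉)
open import Data.Nat.Combinatorics using (_C_)
open import Data.Integer using (+_)
open import Data.Rational using (ℚ; _/_; _+_; _<_; ∣_∣; 0ℚ) renaming (_≤_ to _≤ℚ_; _*_ to _*ℚ_)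
open import Data.Product using (Σ; ∃; _×_; _,_)
open import Relation.Binary.PropositionalEquality using (_≡_)
open Arithmetic using (n≤⌈n/2⌉+⌈n/2⌉; ⌊n/2⌋+⌊n/2⌋≤n)
open Graphs using (completeBipartite; t*n≤degSum-completeBipartite; edgeCount-minor-of-completeBipartite)
open Density using (ε; ε-tendsto-0; ≤-3/4+ε)

theorem1p2 : Σ (ℕ → ℚ) λ ε →
      ((δ : ℚ) → 0ℚ < δ → ∃ λ T → ∀ t → T ≤ t → ∣ ε t ∣ < δ)
      × ((t : ℕ) → ∃ λ (G : Graph) →
          (1 ≤ n G)
          × (t * n G ≤ degSum G)
          × ((H : Graph) → n H ≡ t → IsMinorOf H G →
              (+ edgeCount H / 1) ≤ℚ ((+ 3 / 4 + ε t) *ℚ (+ (t C 2) / 1))))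
theorem1p2 = ε , ε-tendsto-0 , λ t → let a = ⌈ suc t /2⌉ in
    completeBipartite a (t * a)
  , s≤s z≤n
  , t*n≤degSum-completeBipartite t a (n≤⌈n/2⌉+⌈n/2⌉ (suc t))
  , λ H n≡t M → ≤-3/4+ε t
      (edgeCount-minor-of-completeBipartite a (t * a) (⌊n/2⌋+⌊n/2⌋≤n (suc (suc t))) n≡t M)
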